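{- For all integers $k,n,m\geqslant 0$, the poset $\Sigma^k_n C^n_m$ is isomorphic to the subposet of $C^n_{k+m}$ consisting of those elements $(x_1,\dots,x_n)$ satisfying the condition: for each $i\in\{1,\dots,n-1\}$, if $x_{i+1}\in\{0,\dots,k-1\}$ then $x_i\leqslant x_{i+1}$. Moreover, this subposet is a sublattice of $C^n_{k+m}$.
   Context: For $r\geqslant 0$, $C_r$ is the chain $\{0<1<\dots<r\}$ and $C_r^n$ its $n$-th cartesian power with componentwise order (a lattice with componentwise min and max). Stacking (lax sum): given a sequence of posets $M_0,M_1,M_2,\dots$ with monotone maps $f_j\colon M_j\to M_{j+1}$, the poset $\Sigma_nM_n$ has elements the pairs $(x,j)$ with $0\leqslant j\leqslant n$, $x\in M_j$, ordered by $(x,j)\leqslant(y,k)$ iff $j\leqslant k$ and $(f_{k-1}\circ\dots\circ f_j)(x)\leqslant y$ in $M_k$ (identity composite when $j=k$). The maps $f'_n\colon\Sigma_nM_n\to\Sigma_{n+1}M_{n+1}$, $(x,j)\mapsto(x,j)$, make $(\Sigma_nM_n)_{n\geqslant0}$ again such a sequence. Iterated stacking: $\Sigma^0_nM_n=M_n$ and $\Sigma^{k}_nM_n$ is the stacking of the sequence $(\Sigma^{k-1}_nM_n)_{n\geqslant 0}$ with the maps just described. $\Sigma^k_nC^n_m$ denotes the $k$-iterated stacking of the sequence $C^0_m\to C^1_m\to C^2_m\to\dots$ with maps $(x_1,\dots,x_i)\mapsto(0,x_1,\dots,x_i)$. -}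

module Defs where

open import Data.Nat using (ℕ; zero; suc; _+_; _≤′_; ≤′-reflexive; ≤′-step)
  renaming (_≤_ to _≤ℕ_; _<_ to _<ℕ_)
open import Data.Fin using (Fin; toℕ) renaming (zero to fz; suc to fs)
import Data.Fin as F
open import Data.Vec using (Vec; []; _∷_; zipWith)
open import Data.Vec.Relation.Binary.Pointwise.Inductive using (Pointwise)
open import Data.Product using (Σ; _×_; _,_)
open import Data.Unit using (⊤)
open import Relation.Binary.PropositionalEquality using (_≡_; refl)

-- A sequence of posets M₀ → M₁ → M₂ → … : carriers, orders, monotone maps.
-- (Monotonicity/poset axioms are not needed to define the stacking.)
record Seq : Set₁ where
  field
    Car  : ℕ → Set
    Le   : ∀ {n} → Car n → Car n → Set
    step : ∀ {n} → Car n → Car (suc n)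
open Seq public

iter : (M : Seq) → ∀ {j k} → j ≤′ k → Car M j → Car M k
iter M (≤′-reflexive refl) x = x
iter M (≤′-step p) x = step M (iter M p x)

StCar : Seq → ℕ → Set
StCar M n = Σ ℕ λ j → (j ≤ℕ n) × Car M j

StLe : (M : Seq) → ∀ {n} → StCar M n → StCar M n → Set
StLe M (j , _ , x) (k , _ , y) = Σ (j ≤′ k) λ p → Le M (iter M p x) y

StStep : (M : Seq) → ∀ {n} → StCar M n → StCar M (suc n)
StStep M (j , p , x) = j , Data.Nat.Properties.m≤n⇒m≤1+n p , x
  where import Data.Nat.Properties

Stack : Seq → Seq
Stack M = record { Car = StCar M ; Le = StLe M ; step = StStep M }

StackIter : ℕ → Seq → Seq
StackIter zero M = M
StackIter (suc k) M = Stack (StackIter k M)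

Cube : ℕ → Seq
Cube m = record
  { Car  = λ n → Vec (Fin (suc m)) n
  ; Le   = Pointwise F._≤_
  ; step = λ x → fz ∷ x
  }

Adm : (k m : ℕ) → ∀ {n} → Vec (Fin (suc (k + m))) n → Set
Adm k m [] = ⊤
Adm k m (x ∷ []) = ⊤
Adm k m (x ∷ y ∷ xs) = (toℕ y <ℕ k → x F.≤ y) × Adm k m (y ∷ xs)

minF : ∀ {r} → Fin r → Fin r → Fin r
minF fz b = fz
minF (fs a) fz = fz
minF (fs a) (fs b) = fs (minF a b)

maxF : ∀ {r} → Fin r → Fin r → Fin r
maxF fz b = b
maxF (fs a) fz = fs a
maxF (fs a) (fs b) = fs (maxF a b)

-- By induction on k: (x , j) ∈ Σ_n (Σ^k C^•_m)_n goes to the image of x, shifted up by one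
-- and preceded by n - j zeros. The level j is read back from the number of leading zeros, and
-- (x , j) ≤ (y , l) becomes the pointwise order because zeros are below every shifted entry.
-- Conversely, in a vector satisfying the condition for k + 1 an entry 0 forces its predecessor
-- to be 0, so the zeros form a prefix and the rest is the shift of a vector satisfying the
-- condition for k. Closure under min and max holds pairwise for the constraint
-- "x_{i+1} < k implies x_i ≤ x_{i+1}".

module Submission where

open import Defs
open import Data.Nat using (ℕ; zero; suc; _+_; _≤′_; ≤′-refl; ≤′-step; z≤n; s≤s; s≤s⁻¹; _⊓_; _⊔_)
  renaming (_≤_ to _≤ℕ_; _<_ to _<ℕ_)
open import Data.Nat.Properties
  using (≤′⇒≤; ≤⇒≤′; ≤′-trans; 1+n≰n; ≤-antisym; ≤-irrelevant; ≤-total; ≤-trans; ≤-<-trans;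
         m≤n⇒m⊓n≡m; m≥n⇒m⊓n≡n; m⊓n≤m; m⊓n≤n; m≤m⊔n; m≤n⊔m; ⊔-mono-≤)
open import Data.Fin using (Fin; toℕ) renaming (zero to fz; suc to fs)
import Data.Fin as F
import Data.Fin.Properties as FP
open import Data.Vec using (Vec; []; _∷_; map; zipWith)
open import Data.Vec.Properties using (∷-injective; ∷-injectiveʳ)
open import Data.Vec.Relation.Binary.Pointwise.Inductive using (Pointwise; []; _∷_)
import Data.Vec.Relation.Binary.Pointwise.Inductive as PW
open import Data.Product using (Σ; _×_; _,_; proj₂; map₂)
open import Data.Sum using (inj₁; inj₂)
open import Data.Unit using (tt)
open import Data.Empty using (⊥-elim)
open import Function using (id)
open import Function.Bundles using (_⇔_; mk⇔; Equivalence)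
open import Function.Properties.Equivalence using () renaming (sym to ⇔-sym; trans to ⇔-trans)
open import Relation.Binary.Definitions using (Irrelevant)
open import Relation.Binary.PropositionalEquality using (_≡_; refl; sym; trans; cong; cong₂; subst; subst₂)

private
  variable
    r j l n : ℕ

≤′-irrelevant : Irrelevant _≤′_
≤′-irrelevant ≤′-refl      ≤′-refl      = refl
≤′-irrelevant ≤′-refl      (≤′-step q) = ⊥-elim (1+n≰n (≤′⇒≤ q))
≤′-irrelevant (≤′-step p) ≤′-refl      = ⊥-elim (1+n≰n (≤′⇒≤ p))
≤′-irrelevant (≤′-step p) (≤′-step q) = cong ≤′-step (≤′-irrelevant p q)

_≤ᵥ_ : Vec (Fin r) n → Vec (Fin r) n → Set
_≤ᵥ_ = Pointwise F._≤_

≡⇒≤ᵥ : {u v : Vec (Fin r) n} → u ≡ v → u ≤ᵥ v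
≡⇒≤ᵥ refl = PW.refl FP.≤-refl

map-suc-injective : {u v : Vec (Fin r) n} → map fs u ≡ map fs v → u ≡ v
map-suc-injective {u = []}    {[]}    _ = refl
map-suc-injective {u = _ ∷ _} {_ ∷ _} e with ∷-injective e
... | e₁ , e₂ = cong₂ _∷_ (FP.suc-injective e₁) (map-suc-injective e₂)

map-suc⁺ : {u v : Vec (Fin r) n} → u ≤ᵥ v → map fs u ≤ᵥ map fs v
map-suc⁺ = PW.map⁺ s≤s

map-suc⁻ : {u v : Vec (Fin r) n} → map fs u ≤ᵥ map fs v → u ≤ᵥ v
map-suc⁻ {u = []}    {[]}    []      = []
map-suc⁻ {u = _ ∷ _} {_ ∷ _} (h ∷ w) = s≤s⁻¹ h ∷ map-suc⁻ w

-- On the sequence (C^n_r)_n, padZeros p is the composite f_{n-1} ∘ … ∘ f_j of the maps x ↦ (0 , x).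

padZeros : j ≤′ n → Vec (Fin (suc r)) j → Vec (Fin (suc r)) n
padZeros ≤′-refl      v = v
padZeros (≤′-step p) v = fz ∷ padZeros p v

padZeros-trans : (p : j ≤′ l) (q : l ≤′ n) (v : Vec (Fin (suc r)) j) →
                 padZeros q (padZeros p v) ≡ padZeros (≤′-trans p q) v
padZeros-trans p ≤′-refl      v = refl
padZeros-trans p (≤′-step q) v = cong (fz ∷_) (padZeros-trans p q v)

padZeros-factor : (s : j ≤′ l) (p : j ≤′ n) (q : l ≤′ n) (v : Vec (Fin (suc r)) j) →
                  padZeros p v ≡ padZeros q (padZeros s v)
padZeros-factor s p q v =
  trans (cong (λ t → padZeros t v) (≤′-irrelevant p (≤′-trans s q))) (sym (padZeros-trans s q v))

padZeros-injective : (p : j ≤′ n) {u v : Vec (Fin (suc r)) j} → padZeros p u ≡ padZeros p v → u ≡ v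
padZeros-injective ≤′-refl      e = e
padZeros-injective (≤′-step p) e = padZeros-injective p (∷-injectiveʳ e)

padZeros⁺ : (p : j ≤′ n) {u v : Vec (Fin (suc r)) j} → u ≤ᵥ v → padZeros p u ≤ᵥ padZeros p v
padZeros⁺ ≤′-refl      w = w
padZeros⁺ (≤′-step p) w = z≤n ∷ padZeros⁺ p w

padZeros⁻ : (p : j ≤′ n) {u v : Vec (Fin (suc r)) j} → padZeros p u ≤ᵥ padZeros p v → u ≤ᵥ v
padZeros⁻ ≤′-refl      w       = w
padZeros⁻ (≤′-step p) (_ ∷ w) = padZeros⁻ p w

padZeros-map-suc⁺ : (p : j ≤′ n) {a : Vec (Fin (suc r)) j} {b : Vec (Fin (suc r)) n} →
                    padZeros p a ≤ᵥ b → padZeros p (map fs a) ≤ᵥ map fs b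
padZeros-map-suc⁺ ≤′-refl      w                    = map-suc⁺ w
padZeros-map-suc⁺ (≤′-step p) {b = _ ∷ _} (_ ∷ w) = z≤n ∷ padZeros-map-suc⁺ p w

padZeros-map-suc⁻ : (p : j ≤′ n) {a : Vec (Fin (suc r)) j} {b : Vec (Fin (suc r)) n} →
                    padZeros p (map fs a) ≤ᵥ map fs b → padZeros p a ≤ᵥ b
padZeros-map-suc⁻ ≤′-refl      w                    = map-suc⁻ w
padZeros-map-suc⁻ (≤′-step p) {b = _ ∷ _} (_ ∷ w) = z≤n ∷ padZeros-map-suc⁻ p w

shiftPad : j ≤′ n → Vec (Fin (suc r)) j → Vec (Fin (suc (suc r))) n
shiftPad p a = padZeros p (map fs a)

shiftPad-≤⇒≤′ : (p : j ≤′ n) (q : l ≤′ n) {a : Vec (Fin (suc r)) j} {b : Vec (Fin (suc r)) l} →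
                shiftPad p a ≤ᵥ shiftPad q b → j ≤′ l
shiftPad-≤⇒≤′ p            ≤′-refl      w       = p
shiftPad-≤⇒≤′ ≤′-refl      (≤′-step q) {a = _ ∷ _} (() ∷ _)
shiftPad-≤⇒≤′ (≤′-step p) (≤′-step q) (_ ∷ w) = shiftPad-≤⇒≤′ p q w

shiftPad-≤⇔ : (p : j ≤′ n) (q : l ≤′ n) {a : Vec (Fin (suc r)) j} {b : Vec (Fin (suc r)) l} →
              shiftPad p a ≤ᵥ shiftPad q b ⇔ Σ (j ≤′ l) (λ s → padZeros s a ≤ᵥ b)
shiftPad-≤⇔ {j = j} {l = l} p q {a} {b} = mk⇔ to from
  where
  to : shiftPad p a ≤ᵥ shiftPad q b → Σ (j ≤′ l) (λ s → padZeros s a ≤ᵥ b)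
  to w = s , padZeros-map-suc⁻ s (padZeros⁻ q (subst (_≤ᵥ shiftPad q b) (padZeros-factor s p q _) w))
    where s = shiftPad-≤⇒≤′ p q w
  from : Σ (j ≤′ l) (λ s → padZeros s a ≤ᵥ b) → shiftPad p a ≤ᵥ shiftPad q b
  from (s , w) = subst (_≤ᵥ shiftPad q b) (sym (padZeros-factor s p q _)) (padZeros⁺ q (padZeros-map-suc⁺ s w))

shiftPad-length-injective : (p : j ≤′ n) (q : l ≤′ n) {a : Vec (Fin (suc r)) j} {b : Vec (Fin (suc r)) l} →
                            shiftPad p a ≡ shiftPad q b → j ≡ l
shiftPad-length-injective p q e =
  ≤-antisym (≤′⇒≤ (shiftPad-≤⇒≤′ p q (≡⇒≤ᵥ e))) (≤′⇒≤ (shiftPad-≤⇒≤′ q p (≡⇒≤ᵥ (sym e))))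

shiftPad-injective : (p : j ≤′ n) {a b : Vec (Fin (suc r)) j} → shiftPad p a ≡ shiftPad p b → a ≡ b
shiftPad-injective p e = map-suc-injective (padZeros-injective p e)

module _ (m : ℕ) where

  Adm-0 : (v : Vec (Fin (suc m)) n) → Adm 0 m v
  Adm-0 []          = tt
  Adm-0 (_ ∷ [])    = tt
  Adm-0 (_ ∷ y ∷ v) = (λ ()) , Adm-0 (y ∷ v)

  Adm-∷⁻ : ∀ k (x : Fin (suc (k + m))) (v : Vec (Fin (suc (k + m))) n) → Adm k m (x ∷ v) → Adm k m v
  Adm-∷⁻ k x []      _ = tt
  Adm-∷⁻ k x (_ ∷ v) a = proj₂ a

  Adm-fz∷ : ∀ k (v : Vec (Fin (suc (k + m))) n) → Adm k m v → Adm k m (fz ∷ v)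
  Adm-fz∷ k []      _ = tt
  Adm-fz∷ k (_ ∷ v) a = (λ _ → z≤n) , a

  Adm-padZeros : ∀ k (p : j ≤′ n) (v : Vec (Fin (suc (k + m))) j) → Adm k m v → Adm k m (padZeros p v)
  Adm-padZeros k ≤′-refl      v a = a
  Adm-padZeros k (≤′-step p) v a = Adm-fz∷ k _ (Adm-padZeros k p v a)

  Adm-map-suc : ∀ k (v : Vec (Fin (suc (k + m))) n) → Adm k m v → Adm (suc k) m (map fs v)
  Adm-map-suc k []          _         = tt
  Adm-map-suc k (_ ∷ [])    _         = tt
  Adm-map-suc k (_ ∷ y ∷ v) (a₁ , a₂) = (λ lt → s≤s (a₁ (s≤s⁻¹ lt))) , Adm-map-suc k (y ∷ v) a₂

  Adm-shiftPad : ∀ k (p : j ≤′ n) (a : Vec (Fin (suc (k + m))) j) → Adm k m a → Adm (suc k) m (shiftPad p a)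
  Adm-shiftPad k p a adm = Adm-padZeros (suc k) p (map fs a) (Adm-map-suc k a adm)

  -- For suc k, an entry 0 forces its predecessor to be 0, so after a nonzero entry no zero can occur.
  Adm-suc-fs∷ : ∀ k (b : Fin (suc (k + m))) (v : Vec (Fin (suc (suc k + m))) n) →
                Adm (suc k) m (fs b ∷ v) →
                Σ (Vec (Fin (suc (k + m))) n) (λ a → Adm k m (b ∷ a) × map fs a ≡ v)
  Adm-suc-fs∷ k b []        _         = [] , tt , refl
  Adm-suc-fs∷ k b (fz ∷ v)  (a₁ , _) with a₁ (s≤s z≤n)
  ... | ()
  Adm-suc-fs∷ k b (fs c ∷ v) (a₁ , a₂) with Adm-suc-fs∷ k c v a₂
  ... | a , adm , e = c ∷ a , ((λ lt → s≤s⁻¹ (a₁ (s≤s lt))) , adm) , cong (fs c ∷_) e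

  Adm-suc⇒shiftPad : ∀ k (v : Vec (Fin (suc (suc k + m))) n) → Adm (suc k) m v →
                     Σ ℕ λ j → Σ (j ≤′ n) λ p → Σ (Vec (Fin (suc (k + m))) j) λ a →
                       Adm k m a × shiftPad p a ≡ v
  Adm-suc⇒shiftPad k []        _   = 0 , ≤′-refl , [] , tt , refl
  Adm-suc⇒shiftPad k (fz ∷ v)  adm with Adm-suc⇒shiftPad k v (Adm-∷⁻ (suc k) fz v adm)
  ... | j , p , a , adm′ , e = j , ≤′-step p , a , adm′ , cong (fz ∷_) e
  Adm-suc⇒shiftPad k (fs b ∷ v) adm with Adm-suc-fs∷ k b v adm
  ... | a , adm′ , e = _ , ≤′-refl , b ∷ a , adm′ , cong (fs b ∷_) e

Σ-⇔ʳ : ∀ {I : Set} {A B : I → Set} → (∀ i → A i ⇔ B i) → Σ I A ⇔ Σ I B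
Σ-⇔ʳ A⇔B = mk⇔ (map₂ λ {i} → Equivalence.to (A⇔B i)) (map₂ λ {i} → Equivalence.from (A⇔B i))

module Embedding (m : ℕ) where

  S : ℕ → Seq
  S k = StackIter k (Cube m)

  embed : ∀ k → Car (S k) n → Vec (Fin (suc (k + m))) n
  embed zero    x           = x
  embed (suc k) (j , p , x) = shiftPad (≤⇒≤′ p) (embed k x)

  embed-step : ∀ k (x : Car (S k) n) → embed k (step (S k) x) ≡ fz ∷ embed k x
  embed-step zero    x           = refl
  embed-step (suc k) (j , p , x) = cong (λ t → shiftPad t (embed k x)) (≤′-irrelevant _ _)

  embed-iter : ∀ k (s : j ≤′ l) (x : Car (S k) j) → embed k (iter (S k) s x) ≡ padZeros s (embed k x)
  embed-iter k ≤′-refl      x = refl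
  embed-iter k (≤′-step s) x = trans (embed-step k _) (cong (fz ∷_) (embed-iter k s x))

  Adm-embed : ∀ k (x : Car (S k) n) → Adm k m (embed k x)
  Adm-embed zero    x           = Adm-0 m x
  Adm-embed (suc k) (j , p , x) = Adm-shiftPad m k (≤⇒≤′ p) (embed k x) (Adm-embed k x)

  embed-≤⇔ : ∀ k (x y : Car (S k) n) → Le (S k) x y ⇔ embed k x ≤ᵥ embed k y
  embed-≤⇔ zero    x           y           = mk⇔ id id
  embed-≤⇔ (suc k) (j , p , x) (l , q , y) =
    ⇔-trans (Σ-⇔ʳ componentwise) (⇔-sym (shiftPad-≤⇔ (≤⇒≤′ p) (≤⇒≤′ q)))
    where
    componentwise : (s : j ≤′ l) → Le (S k) (iter (S k) s x) y ⇔ padZeros s (embed k x) ≤ᵥ embed k y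
    componentwise s = subst (λ v → Le (S k) (iter (S k) s x) y ⇔ v ≤ᵥ embed k y)
                            (embed-iter k s x) (embed-≤⇔ k (iter (S k) s x) y)

  embed-injective : ∀ k (x y : Car (S k) n) → embed k x ≡ embed k y → x ≡ y
  embed-injective zero    x           y           e = e
  embed-injective (suc k) (j , p , x) (l , q , y) e
    with refl ← shiftPad-length-injective (≤⇒≤′ p) (≤⇒≤′ q) e
    with refl ← ≤-irrelevant p q
    with refl ← embed-injective k x y (shiftPad-injective (≤⇒≤′ p) e)
    = refl

  embed-surjective : ∀ k (v : Vec (Fin (suc (k + m))) n) → Adm k m v →
                     Σ (Car (S k) n) (λ x → embed k x ≡ v)
  embed-surjective zero    v _   = v , refl
  embed-surjective (suc k) v adm with Adm-suc⇒shiftPad m k v adm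
  ... | j , p , a , adm′ , e with embed-surjective k a adm′
  ... | x , refl = (j , ≤′⇒≤ p , x) , trans (cong (λ t → shiftPad t (embed k x)) (≤′-irrelevant _ _)) e

-- Adm k m constrains each consecutive pair (x_i , x_{i+1}) by Guarded k (toℕ x_i) (toℕ x_{i+1}).
Guarded : ℕ → ℕ → ℕ → Set
Guarded k a b = b <ℕ k → a ≤ℕ b

Guarded-⊓ : ∀ {k a b c d} → Guarded k a b → Guarded k c d → Guarded k (a ⊓ c) (b ⊓ d)
Guarded-⊓ {a = a} {b} {c} {d} g₁ g₂ with ≤-total b d
... | inj₁ b≤d rewrite m≤n⇒m⊓n≡m b≤d = λ lt → ≤-trans (m⊓n≤m a c) (g₁ lt)
... | inj₂ d≤b rewrite m≥n⇒m⊓n≡n d≤b = λ lt → ≤-trans (m⊓n≤n a c) (g₂ lt)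

Guarded-⊔ : ∀ {k a b c d} → Guarded k a b → Guarded k c d → Guarded k (a ⊔ c) (b ⊔ d)
Guarded-⊔ {b = b} {d = d} g₁ g₂ lt =
  ⊔-mono-≤ (g₁ (≤-<-trans (m≤m⊔n b d) lt)) (g₂ (≤-<-trans (m≤n⊔m b d) lt))

toℕ-minF : (a b : Fin r) → toℕ (minF a b) ≡ toℕ a ⊓ toℕ b
toℕ-minF fz     b      = refl
toℕ-minF (fs a) fz     = refl
toℕ-minF (fs a) (fs b) = cong suc (toℕ-minF a b)

toℕ-maxF : (a b : Fin r) → toℕ (maxF a b) ≡ toℕ a ⊔ toℕ b
toℕ-maxF fz     b      = refl
toℕ-maxF (fs a) fz     = refl
toℕ-maxF (fs a) (fs b) = cong suc (toℕ-maxF a b)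

module _ (k m : ℕ) (f : Fin (suc (k + m)) → Fin (suc (k + m)) → Fin (suc (k + m))) (_∙_ : ℕ → ℕ → ℕ)
         (toℕ-f : ∀ a b → toℕ (f a b) ≡ toℕ a ∙ toℕ b)
         (Guarded-∙ : ∀ {a b c d} → Guarded k a b → Guarded k c d → Guarded k (a ∙ c) (b ∙ d)) where

  Adm-zipWith : (u v : Vec (Fin (suc (k + m))) n) → Adm k m u → Adm k m v → Adm k m (zipWith f u v)
  Adm-zipWith []          []            _         _         = tt
  Adm-zipWith (_ ∷ [])    (_ ∷ [])      _         _         = tt
  Adm-zipWith (x ∷ y ∷ u) (x′ ∷ y′ ∷ v) (a₁ , a₂) (b₁ , b₂) =
    subst₂ (Guarded k) (sym (toℕ-f x x′)) (sym (toℕ-f y y′)) (Guarded-∙ a₁ b₁)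
    , Adm-zipWith (y ∷ u) (y′ ∷ v) a₂ b₂

theorem2p1 : (k n m : ℕ) →
    Σ (Car (StackIter k (Cube m)) n → Vec (Fin (suc (k + m))) n) (λ φ →
      ((x : Car (StackIter k (Cube m)) n) → Adm k m (φ x))
      × ((x y : Car (StackIter k (Cube m)) n) → φ x ≡ φ y → x ≡ y)
      × ((v : Vec (Fin (suc (k + m))) n) → Adm k m v →
           Σ (Car (StackIter k (Cube m)) n) (λ x → φ x ≡ v))
      × ((x y : Car (StackIter k (Cube m)) n) →
           Le (StackIter k (Cube m)) x y ⇔ Pointwise F._≤_ (φ x) (φ y)))
    × ((u v : Vec (Fin (suc (k + m))) n) → Adm k m u → Adm k m v →
         Adm k m (zipWith minF u v) × Adm k m (zipWith maxF u v))
theorem2p1 k n m =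
  (embed k , Adm-embed k , embed-injective k , embed-surjective k , embed-≤⇔ k)
  , λ u v a b → Adm-zipWith k m minF _⊓_ toℕ-minF Guarded-⊓ u v a b
              , Adm-zipWith k m maxF _⊔_ toℕ-maxF Guarded-⊔ u v a b
  where open Embedding m
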